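{- For every $g\ge 1$ and $k\in\{2,3\}$, the $k$-power domination number of the Sierpiński graph $\mathcal{S}_g$ is $\gamma_{P,k}(\mathcal{S}_g)=1$.
   Context: Sierpiński graph: $\mathcal{S}_1$ is a triangle whose three vertices are its outmost vertices $A_1,B_1,C_1$. Given $\mathcal{S}_g$ with outmost vertices $A_g,B_g,C_g$, take three copies $\mathcal{S}_g^\theta$ ($\theta=1,2,3$) with outmost vertices $A_g^\theta,B_g^\theta,C_g^\theta$, identify $B_g^1$ with $A_g^2$, $C_g^2$ with $B_g^3$, and $C_g^1$ with $A_g^3$; the result is $\mathcal{S}_{g+1}$, with outmost vertices $A_{g+1}=A_g^1$, $B_{g+1}=B_g^2$, $C_{g+1}=C_g^3$ (these have degree 2; all other vertices have degree 4). For a graph $G$, nonnegative integer $k$ and $D\subseteq V(G)$: $P^0_{G,k}(D)=N_G[D]$ (closed neighborhood), $P^{i+1}_{G,k}(D)=\bigcup\{N_G[v]: v\in P^i_{G,k}(D),\ |N_G[v]\setminus P^i_{G,k}(D)|\le k\}$; the increasing sequence stabilizes at $P^\infty_{G,k}(D)$. $D$ is a $k$-power dominating set if $P^\infty_{G,k}(D)=V(G)$; $\gamma_{P,k}(G)$ is the minimum size of such a set. -}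

module Defs where

open import Data.Nat using (ℕ; zero; suc; _≤_; _≤ᵇ_)
open import Data.Fin using (Fin; zero; suc)
open import Data.Bool using (Bool; true; false; _∧_; _∨_; not; if_then_else_)
open import Data.Empty using (⊥)
open import Data.Sum using (_⊎_; inj₁; inj₂)
open import Data.Product using (_×_; _,_; ∃; Σ)
open import Data.Maybe using (Maybe; just; nothing)
open import Data.List using (List; []; _∷_; _++_; map; concatMap; length; filterᵇ)
open import Data.Bool.ListAction using (any)
open import Relation.Binary.PropositionalEquality using (_≡_)

-- Fin 3 utilities.  Corner labels: 0 = A, 1 = B, 2 = C.
-- Copy labels θ = 1,2,3 of the paper are 0,1,2 here.

eq3 : Fin 3 → Fin 3 → Bool
eq3 zero zero = true
eq3 (suc zero) (suc zero) = true
eq3 (suc (suc zero)) (suc (suc zero)) = true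
eq3 _ _ = false

all3 : List (Fin 3)
all3 = zero ∷ suc zero ∷ suc (suc zero) ∷ []

third : Fin 3 → Fin 3 → Fin 3
third zero (suc zero) = suc (suc zero)
third (suc zero) zero = suc (suc zero)
third zero (suc (suc zero)) = suc zero
third (suc (suc zero)) zero = suc zero
third _ _ = zero

-- Vertices of the Sierpiński graph S_g (g ≥ 1), with canonical
-- representatives for the identified vertices of the gluing construction.
--
-- Inner n : non-outmost vertices of S_{n+1}.
--   S_{n+2} = three copies of S_{n+1}; its non-outmost vertices are
--     * the 3 junction vertices (inj₁ j): junction j is the vertex shared
--       by the two copies θ ≠ j (B^1=A^2 is j=2, C^2=B^3 is j=0,
--       C^1=A^3 is j=1);
--     * the inner vertices of each copy (inj₂ (θ , x)).
-- V g : all vertices of S_g; inj₁ c is the outmost vertex with label c.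

Inner : ℕ → Set
Inner zero = ⊥
Inner (suc n) = Fin 3 ⊎ (Fin 3 × Inner n)

V : ℕ → Set
V zero = ⊥            -- S_0 is not defined in the paper; unused
V (suc n) = Fin 3 ⊎ Inner n

-- Embedding ι θ : V(S_{g}) → V(S_{g+1}) of copy θ, realising the
-- identifications B^1=A^2, C^2=B^3, C^1=A^3 and
-- A_{g+1}=A^1, B_{g+1}=B^2, C_{g+1}=C^3.
ι : ∀ n → Fin 3 → V (suc n) → V (suc (suc n))
ι n θ (inj₁ c) = if eq3 θ c then inj₁ c else inj₂ (inj₁ (third θ c))
ι n θ (inj₂ x) = inj₂ (inj₂ (θ , x))

-- Partial inverse of ι θ: the vertex of copy θ corresponding to a vertex
-- of S_{g+1}, if it lies in copy θ.
restrict : ∀ n → Fin 3 → V (suc (suc n)) → Maybe (V (suc n))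
restrict n θ (inj₁ c) = if eq3 θ c then just (inj₁ c) else nothing
restrict n θ (inj₂ (inj₁ j)) = if eq3 θ j then nothing else just (inj₁ (third j θ))
restrict n θ (inj₂ (inj₂ (θ' , x))) = if eq3 θ θ' then just (inj₂ x) else nothing

eqInner : ∀ n → Inner n → Inner n → Bool
eqInner zero () _
eqInner (suc n) (inj₁ a) (inj₁ b) = eq3 a b
eqInner (suc n) (inj₂ (a , x)) (inj₂ (b , y)) = eq3 a b ∧ eqInner n x y
eqInner (suc n) _ _ = false

eqV : ∀ g → V g → V g → Bool
eqV zero () _
eqV (suc n) (inj₁ a) (inj₁ b) = eq3 a b
eqV (suc n) (inj₂ x) (inj₂ y) = eqInner n x y
eqV (suc n) _ _ = false

allInner : ∀ n → List (Inner n)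
allInner zero = []
allInner (suc n) = map inj₁ all3 ++ concatMap (λ θ → map (λ x → inj₂ (θ , x)) (allInner n)) all3

allV : ∀ g → List (V g)
allV zero = []
allV (suc n) = map inj₁ all3 ++ map inj₂ (allInner n)

-- Adjacency: S_1 is a triangle; an edge of S_{g+1} is an edge of one of
-- the three copies (transported along the gluing).
liftAdj : ∀ {A : Set} → (A → A → Bool) → Maybe A → Maybe A → Bool
liftAdj f (just x) (just y) = f x y
liftAdj f _ _ = false

adjS : ∀ n → V (suc n) → V (suc n) → Bool
adjS zero (inj₁ a) (inj₁ b) = not (eq3 a b)
adjS zero (inj₂ ()) _
adjS zero (inj₁ _) (inj₂ ())
adjS (suc n) u v =
  any (λ θ → liftAdj (adjS n) (restrict n θ u) (restrict n θ v)) all3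

adj : ∀ g → V g → V g → Bool
adj zero () _
adj (suc n) = adjS n

inN : ∀ g → V g → V g → Bool
inN g v w = eqV g v w ∨ adj g v w

P : ∀ g (k : ℕ) (D : List (V g)) → ℕ → V g → Bool
P g k D zero w = any (λ d → inN g d w) D
P g k D (suc i) w =
  any (λ v → P g k D i v
             ∧ (length (filterᵇ (λ u → inN g v u ∧ not (P g k D i u)) (allV g)) ≤ᵇ k)
             ∧ inN g v w)
      (allV g)

P∞ : ∀ g (k : ℕ) (D : List (V g)) → V g → Set
P∞ g k D v = ∃ λ i → P g k D i v ≡ true

IsPDS : ∀ g (k : ℕ) → List (V g) → Set
IsPDS g k D = ∀ v → P∞ g k D v

PowerDomNumberIs : ∀ g (k : ℕ) → ℕ → Set
PowerDomNumberIs g k m =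
  (Σ (List (V g)) λ D → length D ≡ m × IsPDS g k D)
  × (∀ D → IsPDS g k D → m ≤ length D)

module Submission where

-- For k ≥ 2 the single vertex A already k-power dominates S_g; a dominating set cannot be
-- empty, so γ_{P,k}(S_g) = 1. The observed set P^∞ is closed under forcing: an observed
-- vertex with at most two unobserved neighbours observes its whole neighbourhood. By
-- induction on g, any such set containing N[A] is everything. It fills copy 1, which contains
-- A, by induction. The junction B^1 = A^2 is then observed and its neighbours in copy 1 are
-- too, so at most the two neighbours of A^2 in copy 2 are not: it forces, copy 2 receives the
-- neighbourhood of its corner A^2, and the induction hypothesis fills it. Copy 3 is the same
-- through C^1 = A^3.

open import Defs
open import Data.Nat using (ℕ; zero; suc; _⊔_; _≤_; _≤′_; _≤ᵇ_; z≤n; s≤s; ≤′-reflexive; ≤′-step)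
open import Data.Nat.Properties using (≤⇒≤ᵇ; ≤ᵇ⇒≤; ≤⇒≤′; m≤m⊔n; m≤n⊔m; ≤-trans)
open import Data.Fin using (Fin; zero; suc)
open import Data.Bool using (Bool; true; false; _∧_; not; T; if_then_else_)
open import Data.Bool.Properties using (T-∧; T-∨; T-≡)
open import Data.Bool.ListAction using (any)
open import Data.Sum using (_⊎_; inj₁; inj₂) renaming (map to ⊎-map; map₁ to ⊎-map₁; map₂ to ⊎-map₂; swap to ⊎-swap)
open import Data.Sum.Properties using (inj₁-injective; inj₂-injective)
open import Data.Product using (_×_; _,_; ∃; ∃₂; proj₁; proj₂)
open import Data.Maybe using (just; nothing)
open import Data.List using (List; []; _∷_; map; length; filterᵇ; cartesianProductWith)
open import Data.List.Properties using (filter-none)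
open import Data.List.Membership.Propositional using (_∈_; lose; find)
open import Data.List.Membership.Propositional.Properties
  using (∈-map⁺; ∈-map⁻; ∈-++⁺ˡ; ∈-++⁺ʳ; ∈-allFin; ∈-cartesianProductWith⁺; ∈-cartesianProductWith⁻)
open import Data.List.Relation.Binary.Disjoint.Propositional using (Disjoint)
open import Data.List.Relation.Unary.All as All using (All; []; _∷_)
open import Data.List.Relation.Unary.All.Properties using (all-filter)
open import Data.List.Relation.Unary.Any using (here; there)
open import Data.List.Relation.Unary.Any.Properties using (any⁺; any⁻)
open import Data.List.Relation.Unary.Unique.Propositional using (Unique; []; _∷_)
import Data.List.Relation.Unary.Unique.Propositional.Properties as Unique
open import Function using (_∘_; const; Equivalence)
open import Relation.Nullary using (¬_; yes; no; contradiction)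
open import Relation.Nullary.Decidable using (T?)
open import Relation.Binary.PropositionalEquality using (_≡_; _≢_; refl; sym; cong; subst; subst₂)

open Equivalence using (to; from)

pattern f0 = zero
pattern f1 = suc zero
pattern f2 = suc (suc zero)

any-intro : ∀ {A : Set} (p : A → Bool) {x xs} → x ∈ xs → T (p x) → T (any p xs)
any-intro p x∈xs px = any⁺ p (lose x∈xs px)

any-elim : ∀ {A : Set} (p : A → Bool) xs → T (any p xs) → ∃ λ x → x ∈ xs × T (p x)
any-elim p xs = find ∘ any⁻ p xs

T-not⇒¬T : ∀ {b} → T (not b) → ¬ T b
T-not⇒¬T {false} _ ()

Unique⇒length≤1 : ∀ {A : Set} {b : A} {xs} → Unique xs → All (_≡ b) xs → length xs ≤ 1
Unique⇒length≤1 [] [] = z≤n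
Unique⇒length≤1 ([] ∷ _) (_ ∷ []) = s≤s z≤n
Unique⇒length≤1 ((x≢y ∷ _) ∷ _) (refl ∷ refl ∷ _) = contradiction refl x≢y

≢×⊎⇒≡ : ∀ {A : Set} {a b x : A} → a ≢ x × (x ≡ a ⊎ x ≡ b) → x ≡ b
≢×⊎⇒≡ (a≢x , inj₁ refl) = contradiction refl a≢x
≢×⊎⇒≡ (_ , inj₂ x≡b) = x≡b

Unique⇒length≤2 : ∀ {A : Set} {a b : A} {xs} → Unique xs → All (λ x → x ≡ a ⊎ x ≡ b) xs
                → length xs ≤ 2
Unique⇒length≤2 [] [] = z≤n
Unique⇒length≤2 (a∉ ∷ u) (inj₁ refl ∷ ps) = s≤s (Unique⇒length≤1 u (All.zipWith ≢×⊎⇒≡ (a∉ , ps)))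
Unique⇒length≤2 (b∉ ∷ u) (inj₂ refl ∷ ps) =
  s≤s (Unique⇒length≤1 u (All.zipWith ≢×⊎⇒≡ (b∉ , All.map ⊎-swap ps)))

eq3-sound : ∀ a b → T (eq3 a b) → a ≡ b
eq3-sound f0 f0 _ = refl
eq3-sound f1 f1 _ = refl
eq3-sound f2 f2 _ = refl
eq3-sound f0 f1 ()
eq3-sound f0 f2 ()
eq3-sound f1 f0 ()
eq3-sound f1 f2 ()
eq3-sound f2 f0 ()
eq3-sound f2 f1 ()

eq3-refl : ∀ a → T (eq3 a a)
eq3-refl f0 = _
eq3-refl f1 = _
eq3-refl f2 = _

eqInner-sound : ∀ n x y → T (eqInner n x y) → x ≡ y
eqInner-sound (suc n) (inj₁ a) (inj₁ b) e = cong inj₁ (eq3-sound a b e)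
eqInner-sound (suc n) (inj₂ (a , x)) (inj₂ (b , y)) e
  with ea , ex ← to T-∧ e
  with refl ← eq3-sound a b ea | refl ← eqInner-sound n x y ex = refl
eqInner-sound (suc n) (inj₁ _) (inj₂ _) ()
eqInner-sound (suc n) (inj₂ _) (inj₁ _) ()

eqInner-refl : ∀ n x → T (eqInner n x x)
eqInner-refl (suc n) (inj₁ a) = eq3-refl a
eqInner-refl (suc n) (inj₂ (a , x)) = from T-∧ (eq3-refl a , eqInner-refl n x)

eqV-sound : ∀ g x y → T (eqV g x y) → x ≡ y
eqV-sound (suc n) (inj₁ a) (inj₁ b) e = cong inj₁ (eq3-sound a b e)
eqV-sound (suc n) (inj₂ x) (inj₂ y) e = cong inj₂ (eqInner-sound n x y e)
eqV-sound (suc n) (inj₁ _) (inj₂ _) ()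
eqV-sound (suc n) (inj₂ _) (inj₁ _) ()

eqV-refl : ∀ g x → T (eqV g x x)
eqV-refl (suc n) (inj₁ a) = eq3-refl a
eqV-refl (suc n) (inj₂ x) = eqInner-refl n x

inN-refl : ∀ g x → T (inN g x x)
inN-refl g x = from T-∨ (inj₁ (eqV-refl g x))

all3-unique : Unique all3
all3-unique = Unique.allFin⁺ 3

copyVertex : ∀ n → Fin 3 → Inner n → Inner (suc n)
copyVertex n θ x = inj₂ (θ , x)

allInner-complete : ∀ n x → x ∈ allInner n
allInner-complete (suc n) (inj₁ j) = ∈-++⁺ˡ (∈-map⁺ inj₁ (∈-allFin j))
allInner-complete (suc n) (inj₂ (θ , x)) =
  ∈-++⁺ʳ (map inj₁ all3)
    (∈-cartesianProductWith⁺ (copyVertex n) {xs = all3} (∈-allFin θ) (allInner-complete n x))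

allV-complete : ∀ g x → x ∈ allV g
allV-complete (suc n) (inj₁ c) = ∈-++⁺ˡ (∈-map⁺ inj₁ (∈-allFin c))
allV-complete (suc n) (inj₂ x) = ∈-++⁺ʳ (map inj₁ all3) (∈-map⁺ inj₂ (allInner-complete n x))

allInner-unique : ∀ n → Unique (allInner n)
allInner-unique zero = []
allInner-unique (suc n) =
  Unique.++⁺ (Unique.map⁺ inj₁-injective all3-unique)
    (Unique.cartesianProductWith⁺ (copyVertex n) copyVertex-injective all3-unique (allInner-unique n))
    junctions∉copies
  where
  copyVertex-injective : ∀ {θ θ′ x y} → copyVertex n θ x ≡ copyVertex n θ′ y → θ ≡ θ′ × x ≡ y
  copyVertex-injective refl = refl , refl
  junctions∉copies : Disjoint (map inj₁ all3) (cartesianProductWith (copyVertex n) all3 (allInner n))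
  junctions∉copies (v∈junctions , v∈copies)
    with _ , _ , refl ← ∈-map⁻ inj₁ v∈junctions
    with () ← ∈-cartesianProductWith⁻ (copyVertex n) all3 (allInner n) v∈copies

allV-unique : ∀ g → Unique (allV g)
allV-unique zero = []
allV-unique (suc n) =
  Unique.++⁺ (Unique.map⁺ inj₁-injective all3-unique) (Unique.map⁺ inj₂-injective (allInner-unique n))
    corners∉inner
  where
  corners∉inner : Disjoint (map inj₁ all3) (map inj₂ (allInner n))
  corners∉inner (v∈corners , v∈inner)
    with _ , _ , refl ← ∈-map⁻ inj₁ v∈corners
    with _ , _ , () ← ∈-map⁻ inj₂ v∈inner

if-just : ∀ {A : Set} b {a x : A} → (if b then just a else nothing) ≡ just x → T b × a ≡ x
if-just true refl = _ , refl

restrict≡just⇒≡ι : ∀ n θ u {x} → restrict n θ u ≡ just x → u ≡ ι n θ x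
restrict≡just⇒≡ι n f0 (inj₁ f0) refl = refl
restrict≡just⇒≡ι n f1 (inj₁ f1) refl = refl
restrict≡just⇒≡ι n f2 (inj₁ f2) refl = refl
restrict≡just⇒≡ι n f0 (inj₁ f1) ()
restrict≡just⇒≡ι n f0 (inj₁ f2) ()
restrict≡just⇒≡ι n f1 (inj₁ f0) ()
restrict≡just⇒≡ι n f1 (inj₁ f2) ()
restrict≡just⇒≡ι n f2 (inj₁ f0) ()
restrict≡just⇒≡ι n f2 (inj₁ f1) ()
restrict≡just⇒≡ι n f0 (inj₂ (inj₁ f0)) ()
restrict≡just⇒≡ι n f1 (inj₂ (inj₁ f1)) ()
restrict≡just⇒≡ι n f2 (inj₂ (inj₁ f2)) ()
restrict≡just⇒≡ι n f0 (inj₂ (inj₁ f1)) refl = refl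
restrict≡just⇒≡ι n f0 (inj₂ (inj₁ f2)) refl = refl
restrict≡just⇒≡ι n f1 (inj₂ (inj₁ f0)) refl = refl
restrict≡just⇒≡ι n f1 (inj₂ (inj₁ f2)) refl = refl
restrict≡just⇒≡ι n f2 (inj₂ (inj₁ f0)) refl = refl
restrict≡just⇒≡ι n f2 (inj₂ (inj₁ f1)) refl = refl
restrict≡just⇒≡ι n θ (inj₂ (inj₂ (θ′ , y))) e
  with θ≡θ′ , refl ← if-just (eq3 θ θ′) e
  with refl ← eq3-sound θ θ′ θ≡θ′ = refl

restrict-ι : ∀ n θ x → restrict n θ (ι n θ x) ≡ just x
restrict-ι n f0 (inj₁ f0) = refl
restrict-ι n f0 (inj₁ f1) = refl
restrict-ι n f0 (inj₁ f2) = refl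
restrict-ι n f1 (inj₁ f0) = refl
restrict-ι n f1 (inj₁ f1) = refl
restrict-ι n f1 (inj₁ f2) = refl
restrict-ι n f2 (inj₁ f0) = refl
restrict-ι n f2 (inj₁ f1) = refl
restrict-ι n f2 (inj₁ f2) = refl
restrict-ι n f0 (inj₂ y) = refl
restrict-ι n f1 (inj₂ y) = refl
restrict-ι n f2 (inj₂ y) = refl

-- The vertices of copy θ that are not identified with a vertex of another copy.
data Unshared (n : ℕ) (θ : Fin 3) : V (suc n) → Set where
  inner : ∀ x → Unshared n θ (inj₂ x)
  corner : Unshared n θ (inj₁ θ)

restrict-ι-unshared : ∀ n {θ θ′ v x} → Unshared n θ v → restrict n θ′ (ι n θ v) ≡ just x
                    → θ′ ≡ θ × x ≡ v
restrict-ι-unshared n {θ} {θ′} (inner y) e with t , refl ← if-just (eq3 θ′ θ) e = eq3-sound θ′ θ t , refl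
restrict-ι-unshared n {f0} {θ′} corner e with t , refl ← if-just (eq3 θ′ f0) e = eq3-sound θ′ f0 t , refl
restrict-ι-unshared n {f1} {θ′} corner e with t , refl ← if-just (eq3 θ′ f1) e = eq3-sound θ′ f1 t , refl
restrict-ι-unshared n {f2} {θ′} corner e with t , refl ← if-just (eq3 θ′ f2) e = eq3-sound θ′ f2 t , refl

liftAdj-just : ∀ {A : Set} (f : A → A → Bool) {mx my} → T (liftAdj f mx my)
             → ∃₂ λ x y → mx ≡ just x × my ≡ just y × T (f x y)
liftAdj-just f {just x} {just y} e = x , y , refl , refl , e

adjS-ι : ∀ n θ {x y} → T (adjS n x y) → T (adjS (suc n) (ι n θ x) (ι n θ y))
adjS-ι n θ {x} {y} e =
  any-intro (λ θ′ → liftAdj (adjS n) (restrict n θ′ (ι n θ x)) (restrict n θ′ (ι n θ y)))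
    (∈-allFin θ)
    (subst₂ (λ mx my → T (liftAdj (adjS n) mx my)) (sym (restrict-ι n θ x)) (sym (restrict-ι n θ y)) e)

adjS-inCopy : ∀ n {w u} → T (adjS (suc n) w u)
            → ∃₂ λ θ x → ∃ λ y → restrict n θ w ≡ just x × u ≡ ι n θ y × T (adjS n x y)
adjS-inCopy n {w} {u} e
  with θ , _ , e′ ← any-elim (λ θ → liftAdj (adjS n) (restrict n θ w) (restrict n θ u)) all3 e
  with x , y , w↦x , u↦y , x~y ← liftAdj-just (adjS n) e′
  = θ , x , y , w↦x , restrict≡just⇒≡ι n θ u u↦y , x~y

adjS-ι-unshared : ∀ n θ {v u} → Unshared n θ v → T (adjS (suc n) (ι n θ v) u)
                → ∃ λ y → u ≡ ι n θ y × T (adjS n v y)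
adjS-ι-unshared n θ {v} {u} unshared e
  with θ′ , x , y , v↦x , refl , x~y ← adjS-inCopy n {ι n θ v} {u} e
  with refl , refl ← restrict-ι-unshared n unshared v↦x
  = y , refl , x~y

inN-ι : ∀ n θ {x y} → T (inN (suc n) x y) → T (inN (suc (suc n)) (ι n θ x) (ι n θ y))
inN-ι n θ {x} {y} e with to T-∨ e
... | inj₁ x≡y with refl ← eqV-sound (suc n) x y x≡y = inN-refl (suc (suc n)) (ι n θ x)
... | inj₂ x~y = from (T-∨ {eqV (suc (suc n)) (ι n θ x) (ι n θ y)}) (inj₂ (adjS-ι n θ x~y))

neighboursOfA : ∀ n → V (suc n) × V (suc n)
neighboursOfA zero = inj₁ f1 , inj₁ f2
neighboursOfA (suc n) = ι n f0 (proj₁ (neighboursOfA n)) , ι n f0 (proj₂ (neighboursOfA n))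

neighboursOfA-complete : ∀ n {u} → T (adjS n (inj₁ f0) u)
                       → u ≡ proj₁ (neighboursOfA n) ⊎ u ≡ proj₂ (neighboursOfA n)
neighboursOfA-complete zero {inj₁ f1} _ = inj₁ refl
neighboursOfA-complete zero {inj₁ f2} _ = inj₂ refl
neighboursOfA-complete (suc n) {u} e with y , refl , A~y ← adjS-ι-unshared n f0 {u = u} corner e =
  ⊎-map (cong (ι n f0)) (cong (ι n f0)) (neighboursOfA-complete n A~y)

adjS-junction : ∀ n θ {j u} → ι n θ (inj₁ f0) ≡ inj₂ (inj₁ j) → T (adjS (suc n) (inj₂ (inj₁ j)) u)
              → (∃ λ y → u ≡ ι n f0 y) ⊎ (∃ λ y → u ≡ ι n θ y × T (adjS n (inj₁ f0) y))
adjS-junction n f1 {u = u} refl e with adjS-inCopy n {inj₂ (inj₁ f2)} {u} e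
... | f0 , _ , y , _ , refl , _ = inj₁ (y , refl)
... | f1 , _ , y , refl , refl , A~y = inj₂ (y , refl , A~y)
... | f2 , _ , _ , () , _
adjS-junction n f2 {u = u} refl e with adjS-inCopy n {inj₂ (inj₁ f1)} {u} e
... | f0 , _ , y , _ , refl , _ = inj₁ (y , refl)
... | f2 , _ , y , refl , refl , A~y = inj₂ (y , refl , A~y)
... | f1 , _ , _ , () , _

ForcesAt : ∀ g → (V g → Set) → V g → Set
ForcesAt g O v =
  ∀ a b → O v → (∀ u → T (adj g v u) → O u ⊎ (u ≡ a ⊎ u ≡ b)) → ∀ w → T (inN g v w) → O w

-- Only non-outmost vertices are required to force, so that the notion restricts to each copy
-- (ForcingClosed-ι): an outmost vertex of a copy may be a junction, whose neighbourhood
-- leaves that copy.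
ForcingClosed : ∀ n → (V (suc n) → Set) → Set
ForcingClosed n O = ∀ x → ForcesAt (suc n) O (inj₂ x)

ForcingClosed-ι : ∀ n θ (O : V (suc (suc n)) → Set) → ForcingClosed (suc n) O
                → ForcingClosed n (O ∘ ι n θ)
ForcingClosed-ι n θ O closed x a b Ox hyp w x~w =
  closed (inj₂ (θ , x)) (ι n θ a) (ι n θ b) Ox hyp′ (ι n θ w) (inN-ι n θ x~w)
  where
  hyp′ : ∀ u → T (adjS (suc n) (inj₂ (inj₂ (θ , x))) u) → O u ⊎ (u ≡ ι n θ a ⊎ u ≡ ι n θ b)
  hyp′ u e with y , refl , x~y ← adjS-ι-unshared n θ {u = u} (inner x) e =
    ⊎-map₂ (⊎-map (cong (ι n θ)) (cong (ι n θ))) (hyp y x~y)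

-- The neighbours of the junction in copy 0 are observed, so only the two neighbours of A
-- in copy θ may not be.
junction-forces : ∀ n (O : V (suc (suc n)) → Set) → ForcingClosed (suc n) O
                → ∀ θ {j} → ι n θ (inj₁ f0) ≡ inj₂ (inj₁ j) → (∀ y → O (ι n f0 y)) → O (inj₂ (inj₁ j))
                → ∀ x → T (inN (suc n) (inj₁ f0) x) → O (ι n θ x)
junction-forces n O closed θ {j} A≡j copy₀ Oj x A~x =
  closed (inj₁ j) (ι n θ (proj₁ (neighboursOfA n))) (ι n θ (proj₂ (neighboursOfA n))) Oj hyp
    (ι n θ x) (subst (λ z → T (inN (suc (suc n)) z (ι n θ x))) A≡j (inN-ι n θ A~x))
  where
  hyp : ∀ u → T (adjS (suc n) (inj₂ (inj₁ j)) u)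
      → O u ⊎ (u ≡ ι n θ (proj₁ (neighboursOfA n)) ⊎ u ≡ ι n θ (proj₂ (neighboursOfA n)))
  hyp u e with adjS-junction n θ {u = u} A≡j e
  ... | inj₁ (y , refl) = inj₁ (copy₀ y)
  ... | inj₂ (y , refl , A~y) =
    inj₂ (⊎-map (cong (ι n θ)) (cong (ι n θ)) (neighboursOfA-complete n A~y))

ForcingClosed⇒all : ∀ n (O : V (suc n) → Set) → ForcingClosed n O
                  → (∀ x → T (inN (suc n) (inj₁ f0) x) → O x) → ∀ x → O x
ForcingClosed⇒all zero O _ N[A]⊆O (inj₁ f0) = N[A]⊆O (inj₁ f0) _
ForcingClosed⇒all zero O _ N[A]⊆O (inj₁ f1) = N[A]⊆O (inj₁ f1) _
ForcingClosed⇒all zero O _ N[A]⊆O (inj₁ f2) = N[A]⊆O (inj₁ f2) _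
ForcingClosed⇒all (suc n) O closed N[A]⊆O = cover
  where
  copy : ∀ θ → (∀ x → T (inN (suc n) (inj₁ f0) x) → O (ι n θ x)) → ∀ y → O (ι n θ y)
  copy θ = ForcingClosed⇒all n (O ∘ ι n θ) (ForcingClosed-ι n θ O closed)
  copy₀ copy₁ copy₂ : ∀ y → O (ι n _ y)
  -- B and C of copy 0 are the corners A of copies 1 and 2.
  copy₀ = copy f0 (λ x A~x → N[A]⊆O (ι n f0 x) (inN-ι n f0 A~x))
  copy₁ = copy f1 (junction-forces n O closed f1 refl copy₀ (copy₀ (inj₁ f1)))
  copy₂ = copy f2 (junction-forces n O closed f2 refl copy₀ (copy₀ (inj₁ f2)))
  cover : ∀ x → O x
  cover (inj₁ f0) = copy₀ (inj₁ f0)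
  cover (inj₁ f1) = copy₁ (inj₁ f1)
  cover (inj₁ f2) = copy₂ (inj₁ f2)
  cover (inj₂ (inj₁ f0)) = copy₁ (inj₁ f2)
  cover (inj₂ (inj₁ f1)) = copy₀ (inj₁ f2)
  cover (inj₂ (inj₁ f2)) = copy₀ (inj₁ f1)
  cover (inj₂ (inj₂ (f0 , x))) = copy₀ (inj₂ x)
  cover (inj₂ (inj₂ (f1 , x))) = copy₁ (inj₂ x)
  cover (inj₂ (inj₂ (f2 , x))) = copy₂ (inj₂ x)

module Process (g k : ℕ) (D : List (V g)) where

  unobserved : ℕ → V g → ℕ
  unobserved i v = length (filterᵇ (λ u → inN g v u ∧ not (P g k D i u)) (allV g))

  P-step : ∀ i v {w} → T (P g k D i v) → unobserved i v ≤ k → T (inN g v w) → T (P g k D (suc i) w)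
  P-step i v {w} Pv few v~w =
    any-intro (λ v′ → P g k D i v′ ∧ (unobserved i v′ ≤ᵇ k) ∧ inN g v′ w) (allV-complete g v)
      (from T-∧ (Pv , from T-∧ (≤⇒≤ᵇ few , v~w)))

  P-step-saturated : ∀ i v {w} → (∀ u → T (inN g v u) → T (P g k D i u)) → T (inN g v w)
                   → T (P g k D (suc i) w)
  P-step-saturated i v N[v]⊆P = P-step i v (N[v]⊆P v (inN-refl g v)) (subst (_≤ k) (sym none) z≤n)
    where
    none : unobserved i v ≡ 0
    none = cong length (filter-none (T? ∘ _) {allV g} (All.tabulate λ {u} _ t →
             let v~u , u∉P = to T-∧ t in T-not⇒¬T u∉P (N[v]⊆P u v~u)))

  P-suc : ∀ i {w} → T (P g k D i w) → T (P g k D (suc i) w)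
  P-suc zero {w} Pw with d , d∈D , d~w ← any-elim (λ d → inN g d w) D Pw =
    P-step-saturated zero d (λ u d~u → any-intro (λ d → inN g d u) d∈D d~u) d~w
  P-suc (suc i) {w} Pw
    with v , _ , t ← any-elim (λ v → P g k D i v ∧ (unobserved i v ≤ᵇ k) ∧ inN g v w) (allV g) Pw
    with Pv , t′ ← to T-∧ t
    with few , v~w ← to T-∧ t′
    = P-step-saturated (suc i) v (λ u v~u → P-step i v Pv (≤ᵇ⇒≤ _ k few) v~u) v~w

  P-mono : ∀ {i j w} → i ≤ j → T (P g k D i w) → T (P g k D j w)
  P-mono i≤j = mono (≤⇒≤′ i≤j)
    where
    mono : ∀ {i j w} → i ≤′ j → T (P g k D i w) → T (P g k D j w)
    mono (≤′-reflexive refl) Pw = Pw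
    mono (≤′-step {j} i≤′j) Pw = P-suc j (mono i≤′j Pw)

  common-stage : (R : V g → Set) → (∀ u → P∞ g k D u ⊎ R u) → ∃ λ i → ∀ u → T (P g k D i u) ⊎ R u
  common-stage R settled = let i , staged = over (allV g) in i , λ u → staged u (allV-complete g u)
    where
    over : ∀ xs → ∃ λ i → ∀ u → u ∈ xs → T (P g k D i u) ⊎ R u
    over [] = 0 , λ _ ()
    over (x ∷ xs) with over xs | settled x
    ... | i , staged | inj₂ r = i , λ { _ (here refl) → inj₂ r ; u (there u∈xs) → staged u u∈xs }
    ... | i , staged | inj₁ (j , Px) = i ⊔ j , λ
      { _ (here refl) → inj₁ (P-mono (m≤n⊔m i j) (from T-≡ Px))
      ; u (there u∈xs) → ⊎-map₁ (P-mono (m≤m⊔n i j)) (staged u u∈xs) }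

  P∞-forcesAt : 2 ≤ k → ∀ v → ForcesAt g (P∞ g k D) v
  P∞-forcesAt 2≤k v a b (i₀ , Pv) hyp w v~w = suc i , to T-≡ (P-step i v Pvᵢ few v~w)
    where
    R : V g → Set
    R u = T (adj g v u) → u ≡ a ⊎ u ≡ b
    settle : ∀ u → P∞ g k D u ⊎ R u
    settle u with T? (adj g v u)
    ... | yes v~u = ⊎-map₂ const (hyp u v~u)
    ... | no ¬v~u = inj₂ (λ v~u → contradiction v~u ¬v~u)
    i₁ i : ℕ
    i₁ = proj₁ (common-stage R settle)
    i = i₀ ⊔ i₁
    Pvᵢ : T (P g k D i v)
    Pvᵢ = P-mono (m≤m⊔n i₀ i₁) (from T-≡ Pv)
    unobserved⇒a∨b : ∀ {u} → T (inN g v u ∧ not (P g k D i u)) → u ≡ a ⊎ u ≡ b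
    unobserved⇒a∨b {u} t
      with u∈N[v] , u∉P ← to T-∧ t
      with proj₂ (common-stage R settle) u | to T-∨ u∈N[v]
    ... | inj₁ Pu | _ = contradiction (P-mono (m≤n⊔m i₀ i₁) Pu) (T-not⇒¬T u∉P)
    ... | inj₂ _ | inj₁ v≡u with refl ← eqV-sound g v u v≡u = contradiction Pvᵢ (T-not⇒¬T u∉P)
    ... | inj₂ near | inj₂ v~u = near v~u
    -- allV g has no repetitions, and the unobserved part of N[v] lies in {a , b}.
    few : unobserved i v ≤ k
    few = ≤-trans (Unique⇒length≤2 (Unique.filter⁺ _ (allV-unique g))
                                   (All.map unobserved⇒a∨b (all-filter _ (allV g))))
                  2≤k

P[]-empty : ∀ g k i v → ¬ T (P g k [] i v)
P[]-empty g k (suc i) v t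
  with v′ , _ , t′ ← any-elim (λ v′ → P g k [] i v′ ∧ _ ∧ inN g v′ v) (allV g) t
  = P[]-empty g k i v′ (proj₁ (to T-∧ t′))

PDS-nonempty : ∀ g k → V g → ∀ D → IsPDS g k D → 1 ≤ length D
PDS-nonempty g k v [] pds with i , Pv ← pds v = contradiction (from T-≡ Pv) (P[]-empty g k i v)
PDS-nonempty g k _ (_ ∷ _) _ = s≤s z≤n

γₚ-Sierpiński≡1 : ∀ n k → 2 ≤ k → PowerDomNumberIs (suc n) k 1
γₚ-Sierpiński≡1 n k 2≤k = (A ∷ [] , refl , A-dominates) , PDS-nonempty (suc n) k A
  where
  A : V (suc n)
  A = inj₁ f0
  open Process (suc n) k (A ∷ [])
  A-dominates : IsPDS (suc n) k (A ∷ [])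
  A-dominates = ForcingClosed⇒all n (P∞ (suc n) k (A ∷ [])) (λ x → P∞-forcesAt 2≤k (inj₂ x))
    (λ x A~x → 0 , to T-≡ (any-intro (λ d → inN (suc n) d x) {xs = A ∷ []} (here refl) A~x))

theorem2 : (g : ℕ) → 1 ≤ g → (k : ℕ) → k ≡ 2 ⊎ k ≡ 3 → PowerDomNumberIs g k 1
theorem2 (suc n) _ k (inj₁ refl) = γₚ-Sierpiński≡1 n k (s≤s (s≤s z≤n))
theorem2 (suc n) _ k (inj₂ refl) = γₚ-Sierpiński≡1 n k (s≤s (s≤s z≤n))
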